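{- Let $p$ be a prime with $p\nmid\mathrm{Vol}(\Delta)$ and $p>(n+4)D$. For $\ell\ge1$ let $\mathbb W_\ell$ denote a set of $\ell$ elements of $\mathbb M(\Delta)$ with minimal weights. (1) For every $m\ge1$, $\min_{\mathbb S^\star\in\mathscr M_\ell(m)}h(\mathbb S^\star)=m\,h(\mathbb W_\ell)$. (2) Order the elements of $\mathbb M(\Delta)$ by weight in non-decreasing order as $P_1,P_2,\dots$, and let $n_1<n_2<\cdots$ be exactly the indices $i$ such that $w(P_{i+1})>w(P_i)$. Then $\mathrm{IHP}(\Delta)$ is the polygon with vertices $(n_i,h(\mathbb W_{n_i}))$.
   Context: Fix $n\ge1$ and linearly independent $\mathbf V_1,\dots,\mathbf V_n\in\mathbb Z^n$; $\Delta=\{\sum_iz_i\mathbf V_i:0\le z_i\le1\}$ with Euclidean volume $\mathrm{Vol}(\Delta)$; $\mathbb M(\Delta)=\{\sum_iz_i\mathbf V_i:z_i\ge0\}\cap\mathbb Z^n$; weight $w(\sum_iz_i\mathbf V_i)=\max_iz_i$; $D$ is the smallest positive integer with all coordinates of elements of $\mathbb M(\Delta)$ in $\frac1D\mathbb Z_{\ge0}$. "Minimal weights": the weights of the elements of $\mathbb W_\ell$ are the $\ell$ smallest weights occurring in $\mathbb M(\Delta)$, with multiplicity. For a finite multiset $\mathbb S^\star$ in $\mathbb M(\Delta)$, $h(\mathbb S^\star)=\sum_{Q\in\mathbb S^\star}(\lfloor w(pQ)\rfloor-\lfloor w(Q)\rfloor)$ with multiplicity. $\mathscr M_\ell(m)$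 is the set of multisets of elements of $\mathbb M(\Delta)$ of total size $m\ell$ with every multiplicity at most $m$. The improved Hodge polygon $\mathrm{IHP}(\Delta)$ is the lower convex hull of $\{(\ell,h(\mathbb W_\ell)):\ell\ge0\}$. -}

module Defs where

open import Data.Nat as ℕ using (ℕ; zero; suc)
open import Data.Integer as ℤ using (ℤ; +_)
open import Data.Rational as ℚ using (ℚ; _/_; 0ℚ; 1ℚ; floor)
open import Data.Fin using (Fin; zero; suc; punchIn)
open import Data.Vec using (Vec; lookup)
open import Data.Vec.Properties using (≡-dec)
open import Data.List using (List; []; _∷_; length; map; filter)
open import Data.List.Membership.Propositional using (_∈_; _∉_)
open import Data.List.Relation.Unary.AllPairs using (AllPairs)
open import Data.Product using (Σ; ∃; _×_; _,_)
open import Relation.Binary.PropositionalEquality using (_≡_; _≢_)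

ℤtoℚ : ℤ → ℚ
ℤtoℚ z = z / 1

ℕtoℚ : ℕ → ℚ
ℕtoℚ k = (+ k) / 1

∑ℚ : ∀ {n} → (Fin n → ℚ) → ℚ
∑ℚ {zero}  f = 0ℚ
∑ℚ {suc n} f = f zero ℚ.+ ∑ℚ (λ i → f (suc i))

∑ℤ : ∀ {n} → (Fin n → ℤ) → ℤ
∑ℤ {zero}  f = + 0
∑ℤ {suc n} f = f zero ℤ.+ ∑ℤ (λ i → f (suc i))

-- maximum over Fin n (starting from 0; weights are maxima of
-- nonnegative coordinates, so this agrees with max_i for n ≥ 1)
maxℚ : ∀ {n} → (Fin n → ℚ) → ℚ
maxℚ {zero}  f = 0ℚ
maxℚ {suc n} f = f zero ℚ.⊔ maxℚ (λ i → f (suc i))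

sgn : ℕ → ℤ
sgn zero          = + 1
sgn (suc zero)    = ℤ.- (+ 1)
sgn (suc (suc j)) = sgn j

det : ∀ {n} → (Fin n → Fin n → ℤ) → ℤ
det {zero}  M = + 1
det {suc n} M =
  ∑ℤ (λ j → sgn (Data.Fin.toℕ j) ℤ.* (M zero j ℤ.* det (λ r c → M (suc r) (punchIn j c))))

module _ {n : ℕ} (V : Fin n → Vec ℤ n) where

  -- linear independence (over ℚ, equivalently over ℝ for integer vectors)
  LinIndep : Set
  LinIndep = (c : Fin n → ℚ) →
             (∀ k → ∑ℚ (λ i → c i ℚ.* ℤtoℚ (lookup (V i) k)) ≡ 0ℚ) →
             ∀ i → c i ≡ 0ℚ

  Vol : ℕ
  Vol = ℤ.∣ det (λ i k → lookup (V i) k) ∣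

  Coords : Vec ℤ n → (Fin n → ℚ) → Set
  Coords Q z = ∀ k → ∑ℚ (λ i → z i ℚ.* ℤtoℚ (lookup (V i) k)) ≡ ℤtoℚ (lookup Q k)

  -- an element of M(Δ): an integer point of the cone, with its coordinates
  record Pt : Set where
    constructor mkPt
    field
      pt     : Vec ℤ n
      coeff  : Fin n → ℚ
      nonneg : ∀ i → 0ℚ ℚ.≤ coeff i
      coords : Coords pt coeff
  open Pt public

  weight : Pt → ℚ
  weight P = maxℚ (coeff P)

  CoordsIn1/ : ℕ → Set
  CoordsIn1/ d = (P : Pt) → ∀ i → ∃ λ (k : ℕ) → ℕtoℚ d ℚ.* coeff P i ≡ ℕtoℚ k

  IsD : ℕ → Set
  IsD d = (1 ℕ.≤ d) × CoordsIn1/ d × (∀ d′ → 1 ℕ.≤ d′ → CoordsIn1/ d′ → d ℕ.≤ d′)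

  -- h(S) = ∑_{Q ∈ S} (⌊w(pQ)⌋ - ⌊w(Q)⌋), with w(pQ) = p·w(Q)
  h : ℕ → List Pt → ℤ
  h p []       = + 0
  h p (Q ∷ S) = (floor (ℕtoℚ p ℚ.* weight Q) ℤ.- floor (weight Q)) ℤ.+ h p S

  mult : List Pt → Pt → ℕ
  mult S Q = length (filter (λ R → ≡-dec ℤ._≟_ (pt R) (pt Q)) S)

  InMset : ℕ → ℕ → List Pt → Set
  InMset ℓ m S = (length S ≡ m ℕ.* ℓ) × (∀ (Q : Pt) → mult S Q ℕ.≤ m)

  MinWeightSet : ℕ → List Pt → Set
  MinWeightSet ℓ W =
    (length W ≡ ℓ) ×
    AllPairs (λ A B → pt A ≢ pt B) W ×
    (∀ (Q : Pt) → pt Q ∉ map pt W → ∀ R → R ∈ W → weight R ℚ.≤ weight Q)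

  -- a finite convex combination: list of (λ_j , ℓ_j)
  ConvComb : Set
  ConvComb = List (ℚ × ℕ)

  IsConvex : ConvComb → Set
  IsConvex c = AllNonneg c × (sumλ c ≡ 1ℚ)
    where
    AllNonneg : ConvComb → Set
    AllNonneg []            = Data.Unit.⊤ where import Data.Unit
    AllNonneg ((a , _) ∷ c) = (0ℚ ℚ.≤ a) × AllNonneg c
    sumλ : ConvComb → ℚ
    sumλ []            = 0ℚ
    sumλ ((a , _) ∷ c) = a ℚ.+ sumλ c

  ccX : ConvComb → ℚ
  ccX []            = 0ℚ
  ccX ((a , ℓ) ∷ c) = a ℚ.* ℕtoℚ ℓ ℚ.+ ccX c

  ccY : (ℕ → ℤ) → ConvComb → ℚ
  ccY H []            = 0ℚ
  ccY H ((a , ℓ) ∷ c) = a ℚ.* ℤtoℚ (H ℓ) ℚ.+ ccY H c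

  IsLowerHullValue : (ℕ → ℤ) → ℚ → ℚ → Set
  IsLowerHullValue H x y =
    (∀ c → IsConvex c → ccX c ≡ x → y ℚ.≤ ccY H c) ×
    (∀ ε → 0ℚ ℚ.< ε → ∃ λ c → IsConvex c × ccX c ≡ x × ccY H c ℚ.< y ℚ.+ ε)

-- The polygon with vertices (0,0), (ns 0, H (ns 0)), (ns 1, H (ns 1)), …
vX : (ℕ → ℕ) → ℕ → ℚ
vX ns zero    = 0ℚ
vX ns (suc k) = ℕtoℚ (ns k)

vY : (ℕ → ℤ) → (ℕ → ℕ) → ℕ → ℚ
vY H ns zero    = 0ℚ
vY H ns (suc k) = ℤtoℚ (H (ns k))

OnPolygon : (ℕ → ℤ) → (ℕ → ℕ) → ℚ → ℚ → Set
OnPolygon H ns x y = ∃ λ k →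
  (vX ns k ℚ.≤ x) × (x ℚ.≤ vX ns (suc k)) ×
  ((vX ns (suc k) ℚ.- vX ns k) ℚ.* (y ℚ.- vY H ns k)
     ≡ (x ℚ.- vX ns k) ℚ.* (vY H ns (suc k) ℚ.- vY H ns k))

{-# OPTIONS --safe #-}
-- Let f(Q) = ⌊p·w(Q)⌋ − ⌊w(Q)⌋, so that h(S) = Σ_{Q ∈ S} f(Q); since p ≥ 1, f is a
-- nondecreasing function of the weight.
--
-- (1) is an exchange argument. Let T be the largest value of f on 𝕎_ℓ; every point
-- outside 𝕎_ℓ has weight at least as large, so f ≥ T there. If S ∈ 𝓜_ℓ(m) contains
-- c_R ≤ m copies of each R ∈ 𝕎_ℓ, then
--   m·h(𝕎_ℓ) ≤ Σ_R c_R f(R) + (mℓ − Σ_R c_R)·T ≤ h(S),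
-- and m copies of 𝕎_ℓ attain the bound.
--
-- (2) By (1) with m = 1 in both directions, h(𝕎_ℓ) = f(P_0) + ⋯ + f(P_{ℓ−1}) is the
-- sequence of partial sums of a nondecreasing sequence: it is convex in ℓ and linear
-- between consecutive indices n_i, where the weight does not jump. Hence each edge of
-- the polygon lies on a line below all the points (ℓ, h(𝕎_ℓ)), which bounds every convex
-- combination from below, and it is itself realised by combining its two endpoints.
module Submission where

open import Defs
open import Data.Empty using (⊥; ⊥-elim)
open import Data.Fin using (Fin; zero; suc)
open import Data.Integer as ℤ using (ℤ; +_; 0ℤ)
import Data.Integer.DivMod as ℤD
import Data.Integer.Properties as ℤP
open import Data.Integer.Tactic.RingSolver using (solve-∀)
open import Data.List using (List; []; _∷_; length; map; filter; _++_; concat; replicate; applyDownFrom; downFrom)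
import Data.List.Extrema ℤP.≤-totalOrder as ℤExtrema
open import Data.List.Membership.Propositional using (_∈_; _∉_)
open import Data.List.Membership.Propositional.Properties using (∈-map⁻; ∈-map⁺)
import Data.List.Properties as ListP
open import Data.List.Relation.Unary.All as All using (All; []; _∷_)
import Data.List.Relation.Unary.All.Properties as AllP
open import Data.List.Relation.Unary.AllPairs using (AllPairs; []; _∷_)
import Data.List.Relation.Unary.AllPairs.Properties as AllPairsP
open import Data.List.Relation.Unary.Any using (here; there)
import Data.List.Relation.Unary.Any.Properties as AnyP
open import Data.Nat as ℕ using (ℕ; zero; suc; _+_; _*_; _≤_; _<_)
open import Data.Nat.Coprimality using (1-coprimeTo) renaming (sym to coprime-sym)
open import Data.Nat.Divisibility using (_∣_)
open import Data.Nat.Primality using (Prime; prime⇒nonZero)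
import Data.Nat.Properties as ℕP
open import Data.Product using (∃; _×_; _,_; proj₁; proj₂)
open import Data.Rational as ℚ using (ℚ; mkℚ; 0ℚ; 1ℚ; floor)
import Data.Rational.Properties as ℚP
open import Algebra.Properties.Group ℚP.+-0-group using (x∙y⁻¹≈ε⇒x≈y; ∙-cancelʳ)
import Data.Rational.Unnormalised as ℚᵘ
import Data.Rational.Unnormalised.Properties as ℚᵘP
open import Data.Sum using (inj₁; inj₂)
open import Data.Vec using (Vec; lookup)
open import Data.Vec.Properties using (≡-dec)
open import Function using (_∘_)
open import Level using (0ℓ)
open import Relation.Binary using (DecidableEquality; Preorder; TotalPreorder)
open import Relation.Binary.PropositionalEquality
open import Relation.Nullary using (yes; no; ¬_)
open import Relation.Nullary.Decidable using (dec⇒maybe)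
import Tactic.RingSolver as RingSolver
import Tactic.RingSolver.Core.AlmostCommutativeRing as ACR

private
  ℚ-ring : ACR.AlmostCommutativeRing 0ℓ 0ℓ
  ℚ-ring = ACR.fromCommutativeRing ℚP.+-*-commutativeRing (λ x → dec⇒maybe (0ℚ ℚP.≟ x))


private
  z/1 : ℤ → ℚ
  z/1 z = mkℚ z 0 (coprime-sym (1-coprimeTo ℤ.∣ z ∣))

  ℤtoℚ≡z/1 : ∀ z → ℤtoℚ z ≡ z/1 z
  ℤtoℚ≡z/1 z = ℚP.↥p/↧p≡p (z/1 z)

  ℕtoℚ-nonNeg : ∀ p → ℚ.NonNegative (ℕtoℚ p)
  ℕtoℚ-nonNeg p = ℚP.normalize-nonNeg p 1

  ℕtoℚ-pos : ∀ p .{{_ : ℕ.NonZero p}} → ℚ.Positive (ℕtoℚ p)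
  ℕtoℚ-pos p = ℚP.normalize-pos p 1

ℤtoℚ-mono-≤ : ∀ {a b} → a ℤ.≤ b → ℤtoℚ a ℚ.≤ ℤtoℚ b
ℤtoℚ-mono-≤ {a} {b} a≤b rewrite ℤtoℚ≡z/1 a | ℤtoℚ≡z/1 b =
  ℚ.*≤* (ℤP.*-monoʳ-≤-nonNeg (+ 1) a≤b)

ℤtoℚ-mono-< : ∀ {a b} → a ℤ.< b → ℤtoℚ a ℚ.< ℤtoℚ b
ℤtoℚ-mono-< {a} {b} a<b rewrite ℤtoℚ≡z/1 a | ℤtoℚ≡z/1 b =
  ℚ.*<* (ℤP.*-monoʳ-<-pos (+ 1) a<b)

ℤtoℚ-cancel-< : ∀ {a b} → ℤtoℚ a ℚ.< ℤtoℚ b → a ℤ.< b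
ℤtoℚ-cancel-< {a} {b} a<b rewrite ℤtoℚ≡z/1 a | ℤtoℚ≡z/1 b with a<b
... | ℚ.*<* a*1<b*1 = ℤP.*-cancelʳ-<-nonNeg (+ 1) a*1<b*1

ℤtoℚ-homo-+ : ∀ a b → ℤtoℚ (a ℤ.+ b) ≡ ℤtoℚ a ℚ.+ ℤtoℚ b
ℤtoℚ-homo-+ a b rewrite ℤtoℚ≡z/1 (a ℤ.+ b) | ℤtoℚ≡z/1 a | ℤtoℚ≡z/1 b =
  ℚP.toℚᵘ-injective (ℚᵘP.≃-trans (ℚᵘ.*≡* (lemma a b)) (ℚᵘP.≃-sym (ℚP.toℚᵘ-homo-+ (z/1 a) (z/1 b))))
  where
  lemma : ∀ a b → (a ℤ.+ b) ℤ.* + 1 ≡ (a ℤ.* + 1 ℤ.+ b ℤ.* + 1) ℤ.* + 1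
  lemma = solve-∀

ℤtoℚ-homo-* : ∀ a b → ℤtoℚ (a ℤ.* b) ≡ ℤtoℚ a ℚ.* ℤtoℚ b
ℤtoℚ-homo-* a b rewrite ℤtoℚ≡z/1 (a ℤ.* b) | ℤtoℚ≡z/1 a | ℤtoℚ≡z/1 b =
  ℚP.toℚᵘ-injective (ℚᵘP.≃-sym (ℚP.toℚᵘ-homo-* (z/1 a) (z/1 b)))

ℤtoℚ-homo‿- : ∀ a → ℤtoℚ (ℤ.- a) ≡ ℚ.- ℤtoℚ a
ℤtoℚ-homo‿- a rewrite ℤtoℚ≡z/1 (ℤ.- a) | ℤtoℚ≡z/1 a =
  ℚP.toℚᵘ-injective (ℚᵘP.≃-sym (ℚP.toℚᵘ-homo‿- (z/1 a)))

ℤtoℚ-homo-- : ∀ a b → ℤtoℚ (a ℤ.- b) ≡ ℤtoℚ a ℚ.- ℤtoℚ b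
ℤtoℚ-homo-- a b = trans (ℤtoℚ-homo-+ a (ℤ.- b)) (cong (ℤtoℚ a ℚ.+_) (ℤtoℚ-homo‿- b))

q≤ℕtoℚ∣↥q∣ : ∀ q → q ℚ.≤ ℕtoℚ ℤ.∣ ℚ.↥ q ∣
q≤ℕtoℚ∣↥q∣ q@(mkℚ (+ m) _ _)     =
  subst (q ℚ.≤_) (sym (ℤtoℚ≡z/1 (+ m))) (ℚ.*≤* (ℤP.*-monoˡ-≤-nonNeg (+ m) (ℤ.+≤+ (ℕ.s≤s ℕ.z≤n))))
q≤ℕtoℚ∣↥q∣ q@(mkℚ ℤ.-[1+ m ] _ _) = subst (q ℚ.≤_) (sym (ℤtoℚ≡z/1 (+ suc m))) (ℚ.*≤* ℤ.-≤+)

⌊q⌋≤q : ∀ q → ℤtoℚ (floor q) ℚ.≤ q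
⌊q⌋≤q q@(mkℚ n d-1 _) rewrite ℤtoℚ≡z/1 (floor q) = ℚ.*≤* (begin
  floor q ℤ.* + suc d-1  ≤⟨ ℤD.[n/d]*d≤n n (+ suc d-1) ⟩
  n                      ≡⟨ ℤP.*-identityʳ n ⟨
  n ℤ.* + 1              ∎)
  where open ℤP.≤-Reasoning

k≤q⇒k≤⌊q⌋ : ∀ {k} q → ℤtoℚ k ℚ.≤ q → k ℤ.≤ floor q
k≤q⇒k≤⌊q⌋ {k} q@(mkℚ n d-1 _) k≤q rewrite ℤtoℚ≡z/1 k with k≤q
... | ℚ.*≤* k*d≤n*1 =
  ℤP.≤-trans (ℤP.i<j⇒i≤pred[j] k<1+⌊q⌋) (ℤP.≤-reflexive (ℤP.pred-suc (floor q)))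
  where
  open ℤP.≤-Reasoning
  d = + suc d-1
  k<1+⌊q⌋ : k ℤ.< ℤ.suc (floor q)
  k<1+⌊q⌋ = ℤP.*-cancelʳ-<-nonNeg d (begin-strict
    k ℤ.* d                        ≤⟨ k*d≤n*1 ⟩
    n ℤ.* + 1                      ≡⟨ ℤP.*-identityʳ n ⟩
    n                              <⟨ ℤD.n<s[n/ℕd]*d n (suc d-1) ⟩
    ℤ.suc (n ℤD./ℕ suc d-1) ℤ.* d  ≡⟨ cong (λ t → ℤ.suc t ℤ.* d) (ℤD.div-pos-is-/ℕ n (suc d-1)) ⟨
    ℤ.suc (floor q) ℤ.* d          ∎)

floor-mono-≤ : ∀ {p q} → p ℚ.≤ q → floor p ℤ.≤ floor q
floor-mono-≤ {p} {q} p≤q = k≤q⇒k≤⌊q⌋ q (ℚP.≤-trans (⌊q⌋≤q p) p≤q)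

q<1+⌊q⌋ : ∀ q → q ℚ.< ℤtoℚ (ℤ.suc (floor q))
q<1+⌊q⌋ q = ℚP.≰⇒> λ 1+⌊q⌋≤q → ℤP.<-irrefl refl (ℤP.suc[i]≤j⇒i<j (k≤q⇒k≤⌊q⌋ q 1+⌊q⌋≤q))

p*⌊q⌋≤⌊p*q⌋ : ∀ p q → + p ℤ.* floor q ℤ.≤ floor (ℕtoℚ p ℚ.* q)
p*⌊q⌋≤⌊p*q⌋ p q = k≤q⇒k≤⌊q⌋ _ (begin
  ℤtoℚ (+ p ℤ.* floor q)     ≡⟨ ℤtoℚ-homo-* (+ p) (floor q) ⟩
  ℕtoℚ p ℚ.* ℤtoℚ (floor q)  ≤⟨ ℚP.*-monoˡ-≤-nonNeg (ℕtoℚ p) {{ℕtoℚ-nonNeg p}} (⌊q⌋≤q q) ⟩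
  ℕtoℚ p ℚ.* q               ∎)
  where open ℚP.≤-Reasoning

⌊p*q⌋<p*[1+⌊q⌋] : ∀ p .{{_ : ℕ.NonZero p}} q → floor (ℕtoℚ p ℚ.* q) ℤ.< + p ℤ.* ℤ.suc (floor q)
⌊p*q⌋<p*[1+⌊q⌋] p q = ℤtoℚ-cancel-< (begin-strict
  ℤtoℚ (floor (ℕtoℚ p ℚ.* q))        ≤⟨ ⌊q⌋≤q _ ⟩
  ℕtoℚ p ℚ.* q                       <⟨ ℚP.*-monoʳ-<-pos (ℕtoℚ p) {{ℕtoℚ-pos p}} (q<1+⌊q⌋ q) ⟩
  ℕtoℚ p ℚ.* ℤtoℚ (ℤ.suc (floor q))  ≡⟨ ℤtoℚ-homo-* (+ p) _ ⟨
  ℤtoℚ (+ p ℤ.* ℤ.suc (floor q))     ∎)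
  where open ℚP.≤-Reasoning

floorGap : ℕ → ℚ → ℤ
floorGap p w = floor (ℕtoℚ p ℚ.* w) ℤ.- floor w

floorGap-mono-≤ : ∀ p .{{_ : ℕ.NonZero p}} {a b} → a ℚ.≤ b → floorGap p a ℤ.≤ floorGap p b
floorGap-mono-≤ p@(suc p-1) {a} {b} a≤b with floor b ℤ.≤? floor a
... | yes ⌊b⌋≤⌊a⌋ = begin
  floor (ℕtoℚ p ℚ.* a) ℤ.- floor a  ≤⟨ ℤP.+-monoˡ-≤ (ℤ.- floor a) (floor-mono-≤ (ℚP.*-monoˡ-≤-nonNeg (ℕtoℚ p) {{ℕtoℚ-nonNeg p}} a≤b)) ⟩
  floor (ℕtoℚ p ℚ.* b) ℤ.- floor a  ≡⟨ cong (λ t → floor (ℕtoℚ p ℚ.* b) ℤ.- t) (ℤP.≤-antisym (floor-mono-≤ a≤b) ⌊b⌋≤⌊a⌋) ⟩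
  floor (ℕtoℚ p ℚ.* b) ℤ.- floor b  ∎
  where open ℤP.≤-Reasoning
... | no ⌊b⌋≰⌊a⌋ = begin
  floor (ℕtoℚ p ℚ.* a) ℤ.- A      ≤⟨ ℤP.+-monoˡ-≤ (ℤ.- A) (ℤP.i<j⇒i≤pred[j] (⌊p*q⌋<p*[1+⌊q⌋] p a)) ⟩
  ℤ.pred (+ p ℤ.* ℤ.suc A) ℤ.- A  ≡⟨ lemma₁ (+ p-1) A ⟩
  + p-1 ℤ.* ℤ.suc A               ≤⟨ ℤP.*-monoˡ-≤-nonNeg (+ p-1) (ℤP.i<j⇒suc[i]≤j (ℤP.≰⇒> ⌊b⌋≰⌊a⌋)) ⟩
  + p-1 ℤ.* B                     ≡⟨ lemma₂ (+ p-1) B ⟩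
  + p ℤ.* B ℤ.- B                 ≤⟨ ℤP.+-monoˡ-≤ (ℤ.- B) (p*⌊q⌋≤⌊p*q⌋ p b) ⟩
  floor (ℕtoℚ p ℚ.* b) ℤ.- B      ∎
  where
  open ℤP.≤-Reasoning
  A = floor a
  B = floor b
  lemma₁ : ∀ q A → ℤ.- + 1 ℤ.+ (+ 1 ℤ.+ q) ℤ.* (+ 1 ℤ.+ A) ℤ.- A ≡ q ℤ.* (+ 1 ℤ.+ A)
  lemma₁ = solve-∀
  lemma₂ : ∀ q B → q ℤ.* B ≡ (+ 1 ℤ.+ q) ℤ.* B ℤ.- B
  lemma₂ = solve-∀


∑ℚ-*-sub : ∀ {n} (a b v : Fin n → ℚ) →
  ∑ℚ (λ i → (a i ℚ.- b i) ℚ.* v i) ≡ ∑ℚ (λ i → a i ℚ.* v i) ℚ.- ∑ℚ (λ i → b i ℚ.* v i)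
∑ℚ-*-sub {zero}  a b v = refl
∑ℚ-*-sub {suc n} a b v =
  trans (cong ((a zero ℚ.- b zero) ℚ.* v zero ℚ.+_) (∑ℚ-*-sub (a ∘ suc) (b ∘ suc) (v ∘ suc)))
        (lemma (a zero) (b zero) (v zero) _ _)
  where
  lemma : ∀ a b v A B → (a ℚ.- b) ℚ.* v ℚ.+ (A ℚ.- B) ≡ (a ℚ.* v ℚ.+ A) ℚ.- (b ℚ.* v ℚ.+ B)
  lemma = RingSolver.solve-∀ ℚ-ring

maxℚ-cong : ∀ {n} {f g : Fin n → ℚ} → (∀ i → f i ≡ g i) → maxℚ f ≡ maxℚ g
maxℚ-cong {zero}  f≗g = refl
maxℚ-cong {suc n} f≗g = cong₂ ℚ._⊔_ (f≗g zero) (maxℚ-cong (f≗g ∘ suc))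

module _ {n} (V : Fin n → Vec ℤ n) (linIndep : LinIndep V) where

  pt≡⇒coeff≡ : ∀ (Q R : Pt V) → pt Q ≡ pt R → ∀ i → coeff Q i ≡ coeff R i
  pt≡⇒coeff≡ Q R Q≡R = x∙y⁻¹≈ε⇒x≈y _ _ ∘ linIndep (λ i → coeff Q i ℚ.- coeff R i) Q-R≡0
    where
    Q-R≡0 : ∀ k → ∑ℚ (λ i → (coeff Q i ℚ.- coeff R i) ℚ.* ℤtoℚ (lookup (V i) k)) ≡ 0ℚ
    Q-R≡0 k = begin
      ∑ℚ (λ i → (coeff Q i ℚ.- coeff R i) ℚ.* ℤtoℚ (lookup (V i) k))
        ≡⟨ ∑ℚ-*-sub (coeff Q) (coeff R) _ ⟩
      ∑ℚ (λ i → coeff Q i ℚ.* ℤtoℚ (lookup (V i) k)) ℚ.- ∑ℚ (λ i → coeff R i ℚ.* ℤtoℚ (lookup (V i) k))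
        ≡⟨ cong₂ ℚ._-_ (coords Q k) (coords R k) ⟩
      ℤtoℚ (lookup (pt Q) k) ℚ.- ℤtoℚ (lookup (pt R) k)
        ≡⟨ cong (λ P → ℤtoℚ (lookup P k) ℚ.- ℤtoℚ (lookup (pt R) k)) Q≡R ⟩
      ℤtoℚ (lookup (pt R) k) ℚ.- ℤtoℚ (lookup (pt R) k)
        ≡⟨ ℚP.+-inverseʳ (ℤtoℚ (lookup (pt R) k)) ⟩
      0ℚ  ∎
      where open ≡-Reasoning

  pt≡⇒weight≡ : ∀ (Q R : Pt V) → pt Q ≡ pt R → weight V Q ≡ weight V R
  pt≡⇒weight≡ Q R Q≡R = maxℚ-cong (pt≡⇒coeff≡ Q R Q≡R)

∑ : {A : Set} → (A → ℤ) → List A → ℤ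
∑ f []       = 0ℤ
∑ f (x ∷ xs) = f x ℤ.+ ∑ f xs

∑-++ : {A : Set} (f : A → ℤ) (xs ys : List A) → ∑ f (xs ++ ys) ≡ ∑ f xs ℤ.+ ∑ f ys
∑-++ f []       ys = sym (ℤP.+-identityˡ (∑ f ys))
∑-++ f (x ∷ xs) ys = trans (cong (ℤ._+_ (f x)) (∑-++ f xs ys)) (sym (ℤP.+-assoc (f x) _ _))

length-concat-replicate : {A : Set} (m : ℕ) (xs : List A) →
                          length (concat (replicate m xs)) ≡ m ℕ.* length xs
length-concat-replicate zero    xs = refl
length-concat-replicate (suc m) xs =
  trans (ListP.length-++ xs) (cong (length xs ℕ.+_) (length-concat-replicate m xs))

∑-concat-replicate : {A : Set} (f : A → ℤ) (m : ℕ) (xs : List A) →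
                     ∑ f (concat (replicate m xs)) ≡ + m ℤ.* ∑ f xs
∑-concat-replicate f zero    xs = sym (ℤP.*-zeroˡ (∑ f xs))
∑-concat-replicate f (suc m) xs = begin
  ∑ f (xs ++ concat (replicate m xs))       ≡⟨ ∑-++ f xs _ ⟩
  ∑ f xs ℤ.+ ∑ f (concat (replicate m xs))  ≡⟨ cong (ℤ._+_ (∑ f xs)) (∑-concat-replicate f m xs) ⟩
  ∑ f xs ℤ.+ + m ℤ.* ∑ f xs                 ≡⟨ ℤP.suc-* (+ m) (∑ f xs) ⟨
  + suc m ℤ.* ∑ f xs                        ∎
  where open ≡-Reasoning

module Exchange {A K : Set} (key : A → K) (_≟_ : DecidableEquality K) where

  open import Data.List.Membership.DecPropositional _≟_ using (_∈?_)

  count : List A → A → ℕ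
  count S Q = length (filter (λ R → key R ≟ key Q) S)

  Distinct : List A → Set
  Distinct = AllPairs (λ Q R → key Q ≢ key R)

  count-∷-≡ : ∀ {Q R} S → key Q ≡ key R → count (Q ∷ S) R ≡ suc (count S R)
  count-∷-≡ {R = R} S Q≡R = cong length (ListP.filter-accept (λ R′ → key R′ ≟ key R) Q≡R)

  count-∷-≢ : ∀ {Q R} S → key Q ≢ key R → count (Q ∷ S) R ≡ count S R
  count-∷-≢ {R = R} S Q≢R = cong length (ListP.filter-reject (λ R′ → key R′ ≟ key R) Q≢R)

  count-++ : ∀ S S′ Q → count (S ++ S′) Q ≡ count S Q ℕ.+ count S′ Q
  count-++ S S′ Q =
    trans (cong length (ListP.filter-++ (λ R → key R ≟ key Q) S S′)) (ListP.length-++ (filter _ S))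

  count-≤1 : ∀ {W} → Distinct W → ∀ Q → count W Q ℕ.≤ 1
  count-≤1 {[]}    []                 Q = ℕ.z≤n
  count-≤1 {R ∷ W} (R≢W ∷ W-distinct) Q with key R ≟ key Q
  ... | yes R≡Q = ℕ.s≤s (ℕP.≤-reflexive (cong length (ListP.filter-none (λ R′ → key R′ ≟ key Q)
                    (All.map (λ R≢R′ R′≡Q → R≢R′ (trans R≡Q (sym R′≡Q))) R≢W))))
  ... | no  _   = count-≤1 W-distinct Q

  count-concat-replicate≤ : ∀ {W} → Distinct W → ∀ m Q → count (concat (replicate m W)) Q ℕ.≤ m
  count-concat-replicate≤     W-distinct zero    Q = ℕ.z≤n
  count-concat-replicate≤ {W} W-distinct (suc m) Q = begin
    count (W ++ concat (replicate m W)) Q           ≡⟨ count-++ W _ Q ⟩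
    count W Q ℕ.+ count (concat (replicate m W)) Q  ≤⟨ ℕP.+-mono-≤ (count-≤1 W-distinct Q)
                                                                   (count-concat-replicate≤ W-distinct m Q) ⟩
    suc m                                           ∎
    where open ℕP.≤-Reasoning

  ∉-map-key : ∀ {Q R W} → All (λ R′ → key R ≢ key R′) W → key Q ≡ key R → key Q ∉ map key W
  ∉-map-key R≢W Q≡R Q∈W with ∈-map⁻ key Q∈W
  ... | R′ , R′∈W , Q≡R′ = All.lookup R≢W R′∈W (trans (sym Q≡R) Q≡R′)

  hits : (A → ℤ) → List A → List A → ℤ
  hits g S = ∑ (λ R → + count S R ℤ.* g R)

  #hits : List A → List A → ℤ
  #hits = hits (λ _ → + 1)

  hits-[] : ∀ g W → hits g [] W ≡ 0ℤ
  hits-[] g []      = refl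
  hits-[] g (R ∷ W) = trans (ℤP.+-identityˡ _) (hits-[] g W)

  hits-∷-∉ : ∀ g {Q} S W → key Q ∉ map key W → hits g (Q ∷ S) W ≡ hits g S W
  hits-∷-∉ g S []      Q∉W = refl
  hits-∷-∉ g S (R ∷ W) Q∉W =
    cong₂ ℤ._+_ (cong (λ c → + c ℤ.* g R) (count-∷-≢ S (Q∉W ∘ here))) (hits-∷-∉ g S W (Q∉W ∘ there))

  hits-∷-∈ : ∀ g → (∀ Q R → key Q ≡ key R → g Q ≡ g R) → ∀ {Q} S W → Distinct W →
             key Q ∈ map key W → hits g (Q ∷ S) W ≡ g Q ℤ.+ hits g S W
  hits-∷-∈ g g-cong {Q} S (R ∷ W) (R≢W ∷ _) (here Q≡R) = begin
    + count (Q ∷ S) R ℤ.* g R ℤ.+ hits g (Q ∷ S) W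
      ≡⟨ cong₂ (λ c h → + c ℤ.* g R ℤ.+ h) (count-∷-≡ S Q≡R) (hits-∷-∉ g S W (∉-map-key R≢W Q≡R)) ⟩
    (+ 1 ℤ.+ + count S R) ℤ.* g R ℤ.+ hits g S W
      ≡⟨ lemma (+ count S R) (g R) (hits g S W) ⟩
    g R ℤ.+ hits g S (R ∷ W)
      ≡⟨ cong (ℤ._+ hits g S (R ∷ W)) (g-cong Q R Q≡R) ⟨
    g Q ℤ.+ hits g S (R ∷ W)  ∎
    where
    open ≡-Reasoning
    lemma : ∀ c x h → (+ 1 ℤ.+ c) ℤ.* x ℤ.+ h ≡ x ℤ.+ (c ℤ.* x ℤ.+ h)
    lemma = solve-∀
  hits-∷-∈ g g-cong {Q} S (R ∷ W) (R≢W ∷ W-distinct) (there Q∈W) = begin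
    + count (Q ∷ S) R ℤ.* g R ℤ.+ hits g (Q ∷ S) W
      ≡⟨ cong₂ (λ c h → + c ℤ.* g R ℤ.+ h) (count-∷-≢ S (λ Q≡R → ∉-map-key R≢W Q≡R Q∈W))
                                           (hits-∷-∈ g g-cong S W W-distinct Q∈W) ⟩
    + count S R ℤ.* g R ℤ.+ (g Q ℤ.+ hits g S W)
      ≡⟨ lemma (+ count S R ℤ.* g R) (g Q) (hits g S W) ⟩
    g Q ℤ.+ hits g S (R ∷ W)  ∎
    where
    open ≡-Reasoning
    lemma : ∀ a x h → a ℤ.+ (x ℤ.+ h) ≡ x ℤ.+ (a ℤ.+ h)
    lemma = solve-∀

  module _ (f : A → ℤ) (T : ℤ) where

    hits-+-≤-∑ : (∀ Q R → key Q ≡ key R → f Q ≡ f R) → ∀ {W} → Distinct W →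
                 (∀ Q → key Q ∉ map key W → T ℤ.≤ f Q) →
                 ∀ S → hits f S W ℤ.+ (+ length S ℤ.- #hits S W) ℤ.* T ℤ.≤ ∑ f S
    hits-+-≤-∑ f-cong {W} W-distinct T≤ []      rewrite hits-[] f W = ℤP.≤-refl
    hits-+-≤-∑ f-cong {W} W-distinct T≤ (Q ∷ S) with key Q ∈? map key W
    ... | yes Q∈W = begin
      hits f (Q ∷ S) W ℤ.+ (+ suc (length S) ℤ.- #hits (Q ∷ S) W) ℤ.* T
        ≡⟨ cong₂ (λ a b → a ℤ.+ (+ suc (length S) ℤ.- b) ℤ.* T)
                 (hits-∷-∈ f f-cong S W W-distinct Q∈W) (hits-∷-∈ _ (λ _ _ _ → refl) S W W-distinct Q∈W) ⟩
      (f Q ℤ.+ hits f S W) ℤ.+ (+ 1 ℤ.+ + length S ℤ.- (+ 1 ℤ.+ #hits S W)) ℤ.* T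
        ≡⟨ lemma (f Q) (hits f S W) (+ length S) (#hits S W) T ⟩
      f Q ℤ.+ (hits f S W ℤ.+ (+ length S ℤ.- #hits S W) ℤ.* T)
        ≤⟨ ℤP.+-monoʳ-≤ (f Q) (hits-+-≤-∑ f-cong W-distinct T≤ S) ⟩
      f Q ℤ.+ ∑ f S  ∎
      where
      open ℤP.≤-Reasoning
      lemma : ∀ x h l c t → (x ℤ.+ h) ℤ.+ (+ 1 ℤ.+ l ℤ.- (+ 1 ℤ.+ c)) ℤ.* t ≡ x ℤ.+ (h ℤ.+ (l ℤ.- c) ℤ.* t)
      lemma = solve-∀
    ... | no Q∉W = begin
      hits f (Q ∷ S) W ℤ.+ (+ suc (length S) ℤ.- #hits (Q ∷ S) W) ℤ.* T
        ≡⟨ cong₂ (λ a b → a ℤ.+ (+ suc (length S) ℤ.- b) ℤ.* T) (hits-∷-∉ f S W Q∉W) (hits-∷-∉ _ S W Q∉W) ⟩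
      hits f S W ℤ.+ (+ 1 ℤ.+ + length S ℤ.- #hits S W) ℤ.* T
        ≡⟨ lemma (hits f S W) (+ length S) (#hits S W) T ⟩
      T ℤ.+ (hits f S W ℤ.+ (+ length S ℤ.- #hits S W) ℤ.* T)
        ≤⟨ ℤP.+-mono-≤ (T≤ Q Q∉W) (hits-+-≤-∑ f-cong W-distinct T≤ S) ⟩
      f Q ℤ.+ ∑ f S  ∎
      where
      open ℤP.≤-Reasoning
      lemma : ∀ h l c t → h ℤ.+ (+ 1 ℤ.+ l ℤ.- c) ℤ.* t ≡ t ℤ.+ (h ℤ.+ (l ℤ.- c) ℤ.* t)
      lemma = solve-∀

    *-∑-≤-hits : ∀ {m S} → (∀ Q → count S Q ℕ.≤ m) → ∀ W → (∀ R → R ∈ W → f R ℤ.≤ T) →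
                 + m ℤ.* ∑ f W ℤ.≤ hits f S W ℤ.+ (+ m ℤ.* + length W ℤ.- #hits S W) ℤ.* T
    *-∑-≤-hits {m} count≤m []      f≤T = ℤP.≤-reflexive (lemma (+ m) T)
      where
      lemma : ∀ m t → m ℤ.* 0ℤ ≡ 0ℤ ℤ.+ (m ℤ.* 0ℤ ℤ.- 0ℤ) ℤ.* t
      lemma = solve-∀
    *-∑-≤-hits {m} {S} count≤m (R ∷ W) f≤T = begin
      + m ℤ.* (f R ℤ.+ ∑ f W)
        ≡⟨ lemma₁ (+ m) c (f R) (∑ f W) ⟩
      (c ℤ.* f R ℤ.+ (+ m ℤ.- c) ℤ.* f R) ℤ.+ + m ℤ.* ∑ f W
        ≤⟨ ℤP.+-mono-≤ (ℤP.+-monoʳ-≤ (c ℤ.* f R) (ℤP.*-monoˡ-≤-nonNeg (+ m ℤ.- c) (f≤T R (here refl))))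
                       (*-∑-≤-hits {m} {S} count≤m W (λ R′ → f≤T R′ ∘ there)) ⟩
      (c ℤ.* f R ℤ.+ (+ m ℤ.- c) ℤ.* T) ℤ.+ (hits f S W ℤ.+ (+ m ℤ.* + length W ℤ.- #hits S W) ℤ.* T)
        ≡⟨ lemma₂ (+ m) c (f R) T (hits f S W) (+ length W) (#hits S W) ⟩
      (c ℤ.* f R ℤ.+ hits f S W) ℤ.+ (+ m ℤ.* (+ 1 ℤ.+ + length W) ℤ.- (c ℤ.* + 1 ℤ.+ #hits S W)) ℤ.* T  ∎
      where
      open ℤP.≤-Reasoning
      c = + count S R
      instance
        _ : ℤ.NonNegative (+ m ℤ.- c)
        _ = ℤ.nonNegative (ℤP.i≤j⇒0≤j-i (ℤ.+≤+ (count≤m R)))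
      lemma₁ : ∀ m c x s → m ℤ.* (x ℤ.+ s) ≡ (c ℤ.* x ℤ.+ (m ℤ.- c) ℤ.* x) ℤ.+ m ℤ.* s
      lemma₁ = solve-∀
      lemma₂ : ∀ m c x t h l k →
        (c ℤ.* x ℤ.+ (m ℤ.- c) ℤ.* t) ℤ.+ (h ℤ.+ (m ℤ.* l ℤ.- k) ℤ.* t)
          ≡ (c ℤ.* x ℤ.+ h) ℤ.+ (m ℤ.* (+ 1 ℤ.+ l) ℤ.- (c ℤ.* + 1 ℤ.+ k)) ℤ.* t
      lemma₂ = solve-∀

  exchange : (f : A → ℤ) → (∀ Q R → key Q ≡ key R → f Q ≡ f R) →
             ∀ {m W S} → Distinct W → (∀ Q → key Q ∉ map key W → ∀ R → R ∈ W → f R ℤ.≤ f Q) →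
             length S ≡ m ℕ.* length W → (∀ Q → count S Q ℕ.≤ m) → + m ℤ.* ∑ f W ℤ.≤ ∑ f S
  exchange f f-cong {m} {[]} {[]}    _ _ _   _ = ℤP.≤-reflexive (ℤP.*-zeroʳ (+ m))
  exchange f f-cong {m} {[]} {_ ∷ _} _ _ len _ with () ← trans len (ℕP.*-zeroʳ m)
  exchange f f-cong {m} {W@(R₀ ∷ W′)} {S} W-distinct W≤ len count≤m = begin
    + m ℤ.* ∑ f W
      ≤⟨ *-∑-≤-hits f T {m} {S} count≤m W below ⟩
    hits f S W ℤ.+ (+ m ℤ.* + length W ℤ.- #hits S W) ℤ.* T
      ≡⟨ cong (λ l → hits f S W ℤ.+ (l ℤ.- #hits S W) ℤ.* T) (trans (cong +_ len) (ℤP.pos-* m (length W))) ⟨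
    hits f S W ℤ.+ (+ length S ℤ.- #hits S W) ℤ.* T
      ≤⟨ hits-+-≤-∑ f T f-cong W-distinct above S ⟩
    ∑ f S  ∎
    where
    open ℤP.≤-Reasoning
    T = ℤExtrema.max (f R₀) (map f W′)
    below : ∀ R → R ∈ W → f R ℤ.≤ T
    below R (here refl)  = ℤExtrema.⊥≤max (f R₀) (map f W′)
    below R (there R∈W′) = All.lookup (ℤExtrema.xs≤max (f R₀) (map f W′)) (∈-map⁺ f R∈W′)
    above : ∀ Q → key Q ∉ map key W → T ℤ.≤ f Q
    above Q Q∉W = ℤExtrema.max≤v⁺ (W≤ Q Q∉W R₀ (here refl)) (AllP.map⁺ (All.tabulate (W≤ Q Q∉W _ ∘ there)))


module _ {n} (V : Fin n → Vec ℤ n) (linIndep : LinIndep V) (p : ℕ) .{{_ : ℕ.NonZero p}} where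
  open Exchange (pt {V = V}) (≡-dec ℤ._≟_)

  h≡∑ : ∀ S → h V p S ≡ ∑ (floorGap p ∘ weight V) S
  h≡∑ []      = refl
  h≡∑ (Q ∷ S) = cong (ℤ._+_ (floorGap p (weight V Q))) (h≡∑ S)

  minWeightSet-exchange : ∀ {ℓ m W} → MinWeightSet V ℓ W → ∀ S → InMset V ℓ m S → + m ℤ.* h V p W ℤ.≤ h V p S
  minWeightSet-exchange {ℓ} {m} {W} (refl , W-distinct , W-minimal) S (|S|≡mℓ , count≤m) =
    subst₂ (λ a b → + m ℤ.* a ℤ.≤ b) (sym (h≡∑ W)) (sym (h≡∑ S))
      (exchange (floorGap p ∘ weight V) (λ Q R → cong (floorGap p) ∘ pt≡⇒weight≡ V linIndep Q R)
        {m} {W} {S} W-distinct (λ Q Q∉W R R∈W → floorGap-mono-≤ p (W-minimal Q Q∉W R R∈W)) |S|≡mℓ count≤m)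

  minWeightSet-replicate : ∀ {ℓ W} → MinWeightSet V ℓ W → ∀ m →
    InMset V ℓ m (concat (replicate m W)) × h V p (concat (replicate m W)) ≡ + m ℤ.* h V p W
  minWeightSet-replicate {W = W} (refl , W-distinct , _) m =
    (length-concat-replicate m W , count-concat-replicate≤ W-distinct m) , (begin
      h V p (concat (replicate m W))                      ≡⟨ h≡∑ (concat (replicate m W)) ⟩
      ∑ (floorGap p ∘ weight V) (concat (replicate m W))  ≡⟨ ∑-concat-replicate _ m W ⟩
      + m ℤ.* ∑ (floorGap p ∘ weight V) W                 ≡⟨ cong (+ m ℤ.*_) (h≡∑ W) ⟨
      + m ℤ.* h V p W                                     ∎)
    where open ≡-Reasoning

  minWeightSet-h-unique : ∀ {ℓ W W′} → MinWeightSet V ℓ W → MinWeightSet V ℓ W′ → h V p W ≡ h V p W′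
  minWeightSet-h-unique {ℓ} minW minW′ = ℤP.≤-antisym (h-≤ minW minW′) (h-≤ minW′ minW)
    where
    h-≤ : ∀ {W W′} → MinWeightSet V ℓ W → MinWeightSet V ℓ W′ → h V p W ℤ.≤ h V p W′
    h-≤ {W} {W′} minW (|W′|≡ℓ , W′-distinct , _) =
      subst (ℤ._≤ h V p W′) (ℤP.*-identityˡ (h V p W))
        (minWeightSet-exchange minW W′ (trans |W′|≡ℓ (sym (ℕP.+-identityʳ ℓ)) , count-≤1 W′-distinct))

  minWeightSet-h≡0 : ∀ {W} → MinWeightSet V 0 W → h V p W ≡ 0ℤ
  minWeightSet-h≡0 minW = minWeightSet-h-unique minW (refl , [] , λ _ _ _ ())

+[m+n]-+m : ∀ m n → + (m ℕ.+ n) ℤ.- + m ≡ + n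
+[m+n]-+m m n = trans (cong (ℤ._- + m) (ℤP.pos-+ m n)) (lemma (+ m) (+ n))
  where
  lemma : ∀ m n → m ℤ.+ n ℤ.- m ≡ n
  lemma = solve-∀

+m-+[m+n] : ∀ m n → + m ℤ.- + (m ℕ.+ n) ≡ ℤ.- + n
+m-+[m+n] m n = trans (cong (ℤ._-_ (+ m)) (ℤP.pos-+ m n)) (lemma (+ m) (+ n))
  where
  lemma : ∀ m n → m ℤ.- (m ℤ.+ n) ≡ ℤ.- n
  lemma = solve-∀

-- The chord from (a, H a) to (b, H b) lies below every point (ℓ, H ℓ); both sides are
-- multiplied by b − a so that the inequality stays in ℤ.
SupportingChord : (ℕ → ℤ) → ℕ → ℕ → Set
SupportingChord H a b =
  ∀ ℓ → (+ b ℤ.- + a) ℤ.* H a ℤ.+ (H b ℤ.- H a) ℤ.* (+ ℓ ℤ.- + a) ℤ.≤ (+ b ℤ.- + a) ℤ.* H ℓ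

module _ (g : ℕ → ℤ) (g-mono : ∀ {i j} → i ℕ.≤ j → g i ℤ.≤ g j) where

  private
    S : ℕ → ℤ
    S ℓ = ∑ g (downFrom ℓ)

  ∑-downFrom-+-≥ : ∀ a d → S a ℤ.+ g a ℤ.* + d ℤ.≤ S (a ℕ.+ d)
  ∑-downFrom-+-≥ a zero    rewrite ℕP.+-identityʳ a =
    ℤP.≤-reflexive (trans (cong (ℤ._+_ (S a)) (ℤP.*-zeroʳ (g a))) (ℤP.+-identityʳ (S a)))
  ∑-downFrom-+-≥ a (suc d) rewrite ℕP.+-suc a d = begin
    S a ℤ.+ g a ℤ.* (+ 1 ℤ.+ + d)  ≡⟨ lemma (S a) (g a) (+ d) ⟩
    g a ℤ.+ (S a ℤ.+ g a ℤ.* + d)  ≤⟨ ℤP.+-mono-≤ (g-mono (ℕP.m≤m+n a d)) (∑-downFrom-+-≥ a d) ⟩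
    g (a ℕ.+ d) ℤ.+ S (a ℕ.+ d)    ∎
    where
    open ℤP.≤-Reasoning
    lemma : ∀ s x d → s ℤ.+ x ℤ.* (+ 1 ℤ.+ d) ≡ x ℤ.+ (s ℤ.+ x ℤ.* d)
    lemma = solve-∀

  ∑-downFrom-+-≤ : ∀ a d → S (a ℕ.+ d) ℤ.≤ S a ℤ.+ g (a ℕ.+ d) ℤ.* + d
  ∑-downFrom-+-≤ a zero    rewrite ℕP.+-identityʳ a =
    ℤP.≤-reflexive (sym (trans (cong (ℤ._+_ (S a)) (ℤP.*-zeroʳ (g a))) (ℤP.+-identityʳ (S a))))
  ∑-downFrom-+-≤ a (suc d) rewrite ℕP.+-suc a d = begin
    g (a ℕ.+ d) ℤ.+ S (a ℕ.+ d)                    ≤⟨ ℤP.+-monoʳ-≤ (g (a ℕ.+ d)) (∑-downFrom-+-≤ a d) ⟩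
    g (a ℕ.+ d) ℤ.+ (S a ℤ.+ g (a ℕ.+ d) ℤ.* + d)  ≡⟨ lemma (S a) (g (a ℕ.+ d)) (+ d) ⟩
    S a ℤ.+ g (a ℕ.+ d) ℤ.* (+ 1 ℤ.+ + d)          ≤⟨ ℤP.+-monoʳ-≤ (S a) (ℤP.*-monoʳ-≤-nonNeg (+ suc d)
                                                                            (g-mono (ℕP.n≤1+n (a ℕ.+ d)))) ⟩
    S a ℤ.+ g (suc (a ℕ.+ d)) ℤ.* + suc d          ∎
    where
    open ℤP.≤-Reasoning
    lemma : ∀ s x d → x ℤ.+ (s ℤ.+ x ℤ.* d) ≡ s ℤ.+ x ℤ.* (+ 1 ℤ.+ d)
    lemma = solve-∀

  ∑-downFrom-tangent : ∀ a ℓ → S a ℤ.+ g a ℤ.* (+ ℓ ℤ.- + a) ℤ.≤ S ℓ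
  ∑-downFrom-tangent a ℓ with ℕP.≤-total a ℓ
  ... | inj₁ a≤ℓ with d , refl ← ℕP.m≤n⇒∃[o]m+o≡n a≤ℓ =
    subst (λ t → S a ℤ.+ g a ℤ.* t ℤ.≤ S (a ℕ.+ d)) (sym (+[m+n]-+m a d)) (∑-downFrom-+-≥ a d)
  ... | inj₂ ℓ≤a with d , refl ← ℕP.m≤n⇒∃[o]m+o≡n ℓ≤a = begin
    S (ℓ ℕ.+ d) ℤ.+ g (ℓ ℕ.+ d) ℤ.* (+ ℓ ℤ.- + (ℓ ℕ.+ d))
      ≡⟨ cong (λ t → S (ℓ ℕ.+ d) ℤ.+ g (ℓ ℕ.+ d) ℤ.* t) (+m-+[m+n] ℓ d) ⟩
    S (ℓ ℕ.+ d) ℤ.+ g (ℓ ℕ.+ d) ℤ.* ℤ.- + d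
      ≤⟨ ℤP.+-monoˡ-≤ (g (ℓ ℕ.+ d) ℤ.* ℤ.- + d) (∑-downFrom-+-≤ ℓ d) ⟩
    S ℓ ℤ.+ g (ℓ ℕ.+ d) ℤ.* + d ℤ.+ g (ℓ ℕ.+ d) ℤ.* ℤ.- + d
      ≡⟨ lemma (S ℓ) (g (ℓ ℕ.+ d)) (+ d) ⟩
    S ℓ  ∎
    where
    open ℤP.≤-Reasoning
    lemma : ∀ s x d → s ℤ.+ x ℤ.* d ℤ.+ x ℤ.* ℤ.- d ≡ s
    lemma = solve-∀

  ∑-downFrom-constant : ∀ a d → (∀ e → e ℕ.< d → g (a ℕ.+ e) ≡ g a) → S (a ℕ.+ d) ≡ S a ℤ.+ g a ℤ.* + d
  ∑-downFrom-constant a zero    _       rewrite ℕP.+-identityʳ a =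
    sym (trans (cong (ℤ._+_ (S a)) (ℤP.*-zeroʳ (g a))) (ℤP.+-identityʳ (S a)))
  ∑-downFrom-constant a (suc d) g≡g[a] rewrite ℕP.+-suc a d = begin
    g (a ℕ.+ d) ℤ.+ S (a ℕ.+ d)    ≡⟨ cong₂ ℤ._+_ (g≡g[a] d (ℕP.n<1+n d))
                                                 (∑-downFrom-constant a d (λ e e<d → g≡g[a] e (ℕP.m<n⇒m<1+n e<d))) ⟩
    g a ℤ.+ (S a ℤ.+ g a ℤ.* + d)  ≡⟨ lemma (S a) (g a) (+ d) ⟩
    S a ℤ.+ g a ℤ.* (+ 1 ℤ.+ + d)  ∎
    where
    open ≡-Reasoning
    lemma : ∀ s x d → x ℤ.+ (s ℤ.+ x ℤ.* d) ≡ s ℤ.+ x ℤ.* (+ 1 ℤ.+ d)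
    lemma = solve-∀

  ∑-downFrom-supportingChord : ∀ {a b} → a ℕ.≤ b → (∀ j → a ℕ.≤ j → suc j ℕ.< b → g j ≡ g (suc j)) →
                               SupportingChord S a b
  ∑-downFrom-supportingChord {a} a≤b flat ℓ with d , refl ← ℕP.m≤n⇒∃[o]m+o≡n a≤b rewrite +[m+n]-+m a d =
    begin
      + d ℤ.* S a ℤ.+ (S (a ℕ.+ d) ℤ.- S a) ℤ.* (+ ℓ ℤ.- + a)
        ≡⟨ cong (λ t → + d ℤ.* S a ℤ.+ (t ℤ.- S a) ℤ.* (+ ℓ ℤ.- + a)) (∑-downFrom-constant a d g≡g[a]) ⟩
      + d ℤ.* S a ℤ.+ (S a ℤ.+ g a ℤ.* + d ℤ.- S a) ℤ.* (+ ℓ ℤ.- + a)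
        ≡⟨ lemma (+ d) (S a) (g a) (+ ℓ ℤ.- + a) ⟩
      + d ℤ.* (S a ℤ.+ g a ℤ.* (+ ℓ ℤ.- + a))
        ≤⟨ ℤP.*-monoˡ-≤-nonNeg (+ d) (∑-downFrom-tangent a ℓ) ⟩
      + d ℤ.* S ℓ  ∎
    where
    open ℤP.≤-Reasoning
    lemma : ∀ d s x t → d ℤ.* s ℤ.+ (s ℤ.+ x ℤ.* d ℤ.- s) ℤ.* t ≡ d ℤ.* (s ℤ.+ x ℤ.* t)
    lemma = solve-∀
    g≡g[a] : ∀ e → e ℕ.< d → g (a ℕ.+ e) ≡ g a
    g≡g[a] zero    _   = cong g (ℕP.+-identityʳ a)
    g≡g[a] (suc e) e<d = begin-equality
      g (a ℕ.+ suc e)    ≡⟨ cong g (ℕP.+-suc a e) ⟩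
      g (suc (a ℕ.+ e))  ≡⟨ flat (a ℕ.+ e) (ℕP.m≤m+n a e) (subst (ℕ._< a ℕ.+ d) (ℕP.+-suc a e) (ℕP.+-monoʳ-< a e<d)) ⟨
      g (a ℕ.+ e)        ≡⟨ g≡g[a] e (ℕP.<-trans (ℕP.n<1+n e) e<d) ⟩
      g a                ∎


module _ {c ℓ₁ ℓ₂} (≲-preorder : Preorder c ℓ₁ ℓ₂) where
  open Preorder ≲-preorder using (Carrier; _≲_) renaming (refl to ≲-refl; trans to ≲-trans)

  mono-from-step : (u : ℕ → Carrier) → (∀ i → u i ≲ u (suc i)) → ∀ {i j} → i ℕ.≤ j → u i ≲ u j
  mono-from-step u u-step i≤j = go (ℕP.≤⇒≤′ i≤j)
    where
    go : ∀ {i j} → i ℕ.≤′ j → u i ≲ u j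
    go ℕ.≤′-refl         = ≲-refl
    go (ℕ.≤′-step i≤′j) = ≲-trans (go i≤′j) (u-step _)

module _ (v : ℕ → ℕ) (v-< : ∀ k → v k ℕ.< v (suc k)) where

  strictMono-reflects-< : ∀ {i j} → v i ℕ.< v j → i ℕ.< j
  strictMono-reflects-< {i} {j} vi<vj with i ℕP.<? j
  ... | yes i<j = i<j
  ... | no  i≮j = ⊥-elim (ℕP.<-irrefl refl (ℕP.<-≤-trans vi<vj
                    (mono-from-step ℕP.≤-preorder v (ℕP.<⇒≤ ∘ v-<) (ℕP.≮⇒≥ i≮j))))

  strictMono-no-between : ∀ {k k′} → v k ℕ.< v k′ → v k′ ℕ.< v (suc k) → ⊥
  strictMono-no-between vk<vk′ vk′<v[1+k] = ℕP.<-irrefl refl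
    (ℕP.<-≤-trans (strictMono-reflects-< vk<vk′) (ℕP.≤-pred (strictMono-reflects-< vk′<v[1+k])))

p≤q⇒0≤q-p : ∀ {p q} → p ℚ.≤ q → 0ℚ ℚ.≤ q ℚ.- p
p≤q⇒0≤q-p {p} {q} p≤q = subst (ℚ._≤ q ℚ.- p) (ℚP.+-inverseʳ p) (ℚP.+-monoˡ-≤ (ℚ.- p) p≤q)

p<q⇒0<q-p : ∀ {p q} → p ℚ.< q → 0ℚ ℚ.< q ℚ.- p
p<q⇒0<q-p {p} {q} p<q = subst (ℚ._< q ℚ.- p) (ℚP.+-inverseʳ p) (ℚP.+-monoˡ-< (ℚ.- p) p<q)

0≤p*q : ∀ {p q} → 0ℚ ℚ.≤ p → 0ℚ ℚ.≤ q → 0ℚ ℚ.≤ p ℚ.* q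
0≤p*q {p} {q} 0≤p 0≤q =
  ℚP.nonNegative⁻¹ (p ℚ.* q) {{ℚP.nonNeg*nonNeg⇒nonNeg p {{ℚ.nonNegative 0≤p}} q {{ℚ.nonNegative 0≤q}}}}

segment : (u : ℕ → ℚ) {x : ℚ} (N : ℕ) → u 0 ℚ.≤ x → x ℚ.≤ u (suc N) → ∃ λ k → u k ℚ.≤ x × x ℚ.≤ u (suc k)
segment u         zero    u₀≤x x≤u₁ = 0 , u₀≤x , x≤u₁
segment u {x} (suc N) u₀≤x x≤u with x ℚP.≤? u (suc N)
... | yes x≤u[N] = segment u N u₀≤x x≤u[N]
... | no  x≰u[N] = suc N , ℚP.<⇒≤ (ℚP.≰⇒> x≰u[N]) , x≤u

vertex : (ℕ → ℕ) → ℕ → ℕ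
vertex ns zero    = 0
vertex ns (suc k) = ns k

vertex-< : ∀ {ns} → 0 ℕ.< ns 0 → (∀ k → ns k ℕ.< ns (suc k)) → ∀ k → vertex ns k ℕ.< vertex ns (suc k)
vertex-< 0<ns₀ ns-< zero    = 0<ns₀
vertex-< 0<ns₀ ns-< (suc k) = ns-< k

module _ {n} (V : Fin n → Vec ℤ n) (H : ℕ → ℤ) where

  weightSum : ConvComb V → ℚ
  weightSum []            = 0ℚ
  weightSum ((a , _) ∷ c) = a ℚ.+ weightSum c

  NonNegWeights : ConvComb V → Set
  NonNegWeights = All (λ w → 0ℚ ℚ.≤ proj₁ w)

  -- The nonnegativity predicate inside IsConvex is local to its definition and cannot be
  -- named, so the tail is reached by repeatedly merging the first two weights.
  private
    convex-tail : ∀ a c → IsConvex V ((a , 0) ∷ c) → NonNegWeights c × a ℚ.+ weightSum c ≡ 1ℚ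
    convex-tail a []            (_ , a+0≡1) = [] , a+0≡1
    convex-tail a ((b , _) ∷ c) ((0≤a , 0≤b , c≥0) , a+[b+c]≡1)
      with convex-tail (a ℚ.+ b) c ((ℚP.+-mono-≤ 0≤a 0≤b , c≥0) , trans (ℚP.+-assoc a b _) a+[b+c]≡1)
    ... | c≥0′ , [a+b]+c≡1 = 0≤b ∷ c≥0′ , trans (sym (ℚP.+-assoc a b (weightSum c))) [a+b]+c≡1

  convex⇒nonNegWeights : ∀ c → IsConvex V c → NonNegWeights c × weightSum c ≡ 1ℚ
  convex⇒nonNegWeights []            (_ , 0≡1) = [] , 0≡1
  convex⇒nonNegWeights ((a , _) ∷ c) cvx@((0≤a , _) , _) with convex-tail a c cvx
  ... | c≥0 , a+c≡1 = 0≤a ∷ c≥0 , a+c≡1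

  affine-≤-ccY : ∀ α β d → (∀ ℓ → α ℚ.+ β ℚ.* ℕtoℚ ℓ ℚ.≤ d ℚ.* ℤtoℚ (H ℓ)) →
                 ∀ c → NonNegWeights c → α ℚ.* weightSum c ℚ.+ β ℚ.* ccX V c ℚ.≤ d ℚ.* ccY V H c
  affine-≤-ccY α β d line≤H []            []          = ℚP.≤-reflexive (lemma α β d)
    where
    lemma : ∀ α β d → α ℚ.* 0ℚ ℚ.+ β ℚ.* 0ℚ ≡ d ℚ.* 0ℚ
    lemma = RingSolver.solve-∀ ℚ-ring
  affine-≤-ccY α β d line≤H ((a , ℓ) ∷ c) (0≤a ∷ c≥0) = begin
    α ℚ.* (a ℚ.+ weightSum c) ℚ.+ β ℚ.* (a ℚ.* ℕtoℚ ℓ ℚ.+ ccX V c)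
      ≡⟨ lemma₁ α β a (weightSum c) (ℕtoℚ ℓ) (ccX V c) ⟩
    a ℚ.* (α ℚ.+ β ℚ.* ℕtoℚ ℓ) ℚ.+ (α ℚ.* weightSum c ℚ.+ β ℚ.* ccX V c)
      ≤⟨ ℚP.+-mono-≤ (ℚP.*-monoˡ-≤-nonNeg a {{ℚ.nonNegative 0≤a}} (line≤H ℓ)) (affine-≤-ccY α β d line≤H c c≥0) ⟩
    a ℚ.* (d ℚ.* ℤtoℚ (H ℓ)) ℚ.+ d ℚ.* ccY V H c
      ≡⟨ lemma₂ a d (ℤtoℚ (H ℓ)) (ccY V H c) ⟩
    d ℚ.* (a ℚ.* ℤtoℚ (H ℓ) ℚ.+ ccY V H c)  ∎
    where
    open ℚP.≤-Reasoning
    lemma₁ : ∀ α β a s l x → α ℚ.* (a ℚ.+ s) ℚ.+ β ℚ.* (a ℚ.* l ℚ.+ x)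
                             ≡ a ℚ.* (α ℚ.+ β ℚ.* l) ℚ.+ (α ℚ.* s ℚ.+ β ℚ.* x)
    lemma₁ = RingSolver.solve-∀ ℚ-ring
    lemma₂ : ∀ a d h y → a ℚ.* (d ℚ.* h) ℚ.+ d ℚ.* y ≡ d ℚ.* (a ℚ.* h ℚ.+ y)
    lemma₂ = RingSolver.solve-∀ ℚ-ring

  module _ {ℓ₁ ℓ₂ : ℕ} (ℓ₁<ℓ₂ : ℕtoℚ ℓ₁ ℚ.< ℕtoℚ ℓ₂) where

    private
      a = ℕtoℚ ℓ₁
      b = ℕtoℚ ℓ₂
      A = ℤtoℚ (H ℓ₁)
      B = ℤtoℚ (H ℓ₂)
      D = b ℚ.- a
      instance
        D-positive : ℚ.Positive D
        D-positive = ℚ.positive (p<q⇒0<q-p ℓ₁<ℓ₂)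
        D-nonZero : ℚ.NonZero D
        D-nonZero = ℚP.pos⇒nonZero D
      i = ℚ.1/ D
      0≤i : 0ℚ ℚ.≤ i
      0≤i = ℚP.<⇒≤ (ℚP.positive⁻¹ i {{ℚP.1/pos⇒pos D}})
      D*i≡1 : D ℚ.* i ≡ 1ℚ
      D*i≡1 = ℚP.*-inverseʳ D

    chord : ∀ {x} → a ℚ.≤ x → x ℚ.≤ b →
            ∃ λ c → IsConvex V c × ccX V c ≡ x × D ℚ.* (ccY V H c ℚ.- A) ≡ (x ℚ.- a) ℚ.* (B ℚ.- A)
    chord {x} a≤x x≤b = c , convex , x-coordinate , y-coordinate
      where
      open ≡-Reasoning
      c : ConvComb V
      c = ((b ℚ.- x) ℚ.* i , ℓ₁) ∷ ((x ℚ.- a) ℚ.* i , ℓ₂) ∷ []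
      convex : IsConvex V c
      convex = (0≤p*q (p≤q⇒0≤q-p x≤b) 0≤i , 0≤p*q (p≤q⇒0≤q-p a≤x) 0≤i , _) , (begin
        (b ℚ.- x) ℚ.* i ℚ.+ ((x ℚ.- a) ℚ.* i ℚ.+ 0ℚ)  ≡⟨ lemma a b x i ⟩
        D ℚ.* i                                      ≡⟨ D*i≡1 ⟩
        1ℚ                                           ∎)
        where
        lemma : ∀ a b x i → (b ℚ.- x) ℚ.* i ℚ.+ ((x ℚ.- a) ℚ.* i ℚ.+ 0ℚ) ≡ (b ℚ.- a) ℚ.* i
        lemma = RingSolver.solve-∀ ℚ-ring
      x-coordinate : ccX V c ≡ x
      x-coordinate = begin
        (b ℚ.- x) ℚ.* i ℚ.* a ℚ.+ ((x ℚ.- a) ℚ.* i ℚ.* b ℚ.+ 0ℚ)  ≡⟨ lemma a b x i ⟩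
        x ℚ.* (D ℚ.* i)                                          ≡⟨ cong (x ℚ.*_) D*i≡1 ⟩
        x ℚ.* 1ℚ                                                 ≡⟨ ℚP.*-identityʳ x ⟩
        x                                                        ∎
        where
        lemma : ∀ a b x i → (b ℚ.- x) ℚ.* i ℚ.* a ℚ.+ ((x ℚ.- a) ℚ.* i ℚ.* b ℚ.+ 0ℚ) ≡ x ℚ.* ((b ℚ.- a) ℚ.* i)
        lemma = RingSolver.solve-∀ ℚ-ring
      y-coordinate : D ℚ.* (ccY V H c ℚ.- A) ≡ (x ℚ.- a) ℚ.* (B ℚ.- A)
      y-coordinate = begin
        D ℚ.* ((b ℚ.- x) ℚ.* i ℚ.* A ℚ.+ ((x ℚ.- a) ℚ.* i ℚ.* B ℚ.+ 0ℚ) ℚ.- A)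
          ≡⟨ lemma₁ a b x i A B ⟩
        D ℚ.* i ℚ.* ((b ℚ.- x) ℚ.* A ℚ.+ (x ℚ.- a) ℚ.* B) ℚ.- D ℚ.* A
          ≡⟨ cong (λ t → t ℚ.* ((b ℚ.- x) ℚ.* A ℚ.+ (x ℚ.- a) ℚ.* B) ℚ.- D ℚ.* A) D*i≡1 ⟩
        1ℚ ℚ.* ((b ℚ.- x) ℚ.* A ℚ.+ (x ℚ.- a) ℚ.* B) ℚ.- D ℚ.* A
          ≡⟨ lemma₂ a b x A B ⟩
        (x ℚ.- a) ℚ.* (B ℚ.- A)  ∎
        where
        lemma₁ : ∀ a b x i A B → (b ℚ.- a) ℚ.* ((b ℚ.- x) ℚ.* i ℚ.* A ℚ.+ ((x ℚ.- a) ℚ.* i ℚ.* B ℚ.+ 0ℚ) ℚ.- A)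
                                 ≡ (b ℚ.- a) ℚ.* i ℚ.* ((b ℚ.- x) ℚ.* A ℚ.+ (x ℚ.- a) ℚ.* B) ℚ.- (b ℚ.- a) ℚ.* A
        lemma₁ = RingSolver.solve-∀ ℚ-ring
        lemma₂ : ∀ a b x A B → 1ℚ ℚ.* ((b ℚ.- x) ℚ.* A ℚ.+ (x ℚ.- a) ℚ.* B) ℚ.- (b ℚ.- a) ℚ.* A
                               ≡ (x ℚ.- a) ℚ.* (B ℚ.- A)
        lemma₂ = RingSolver.solve-∀ ℚ-ring

    chord⇒lowerHullValue : ∀ {x y} → a ℚ.≤ x → x ℚ.≤ b → D ℚ.* (y ℚ.- A) ≡ (x ℚ.- a) ℚ.* (B ℚ.- A) →
      (∀ ℓ → D ℚ.* A ℚ.+ (B ℚ.- A) ℚ.* (ℕtoℚ ℓ ℚ.- a) ℚ.≤ D ℚ.* ℤtoℚ (H ℓ)) → IsLowerHullValue V H x y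
    chord⇒lowerHullValue {x} {y} a≤x x≤b y-on-chord chord≤H = lower-bound , attained
      where
      α = D ℚ.* A ℚ.- (B ℚ.- A) ℚ.* a
      line≤H : ∀ ℓ → α ℚ.+ (B ℚ.- A) ℚ.* ℕtoℚ ℓ ℚ.≤ D ℚ.* ℤtoℚ (H ℓ)
      line≤H ℓ = subst (ℚ._≤ D ℚ.* ℤtoℚ (H ℓ)) (lemma D A B a (ℕtoℚ ℓ)) (chord≤H ℓ)
        where
        lemma : ∀ D A B a t → D ℚ.* A ℚ.+ (B ℚ.- A) ℚ.* (t ℚ.- a) ≡ D ℚ.* A ℚ.- (B ℚ.- A) ℚ.* a ℚ.+ (B ℚ.- A) ℚ.* t
        lemma = RingSolver.solve-∀ ℚ-ring
      D*y : D ℚ.* y ≡ α ℚ.* 1ℚ ℚ.+ (B ℚ.- A) ℚ.* x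
      D*y = begin
        D ℚ.* y                              ≡⟨ lemma₁ D y A ⟩
        D ℚ.* A ℚ.+ D ℚ.* (y ℚ.- A)          ≡⟨ cong (D ℚ.* A ℚ.+_) y-on-chord ⟩
        D ℚ.* A ℚ.+ (x ℚ.- a) ℚ.* (B ℚ.- A)  ≡⟨ lemma₂ D A B a x ⟩
        α ℚ.* 1ℚ ℚ.+ (B ℚ.- A) ℚ.* x         ∎
        where
        open ≡-Reasoning
        lemma₁ : ∀ D y A → D ℚ.* y ≡ D ℚ.* A ℚ.+ D ℚ.* (y ℚ.- A)
        lemma₁ = RingSolver.solve-∀ ℚ-ring
        lemma₂ : ∀ D A B a x → D ℚ.* A ℚ.+ (x ℚ.- a) ℚ.* (B ℚ.- A)
                               ≡ (D ℚ.* A ℚ.- (B ℚ.- A) ℚ.* a) ℚ.* 1ℚ ℚ.+ (B ℚ.- A) ℚ.* x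
        lemma₂ = RingSolver.solve-∀ ℚ-ring
      lower-bound : ∀ c → IsConvex V c → ccX V c ≡ x → y ℚ.≤ ccY V H c
      lower-bound c cvx cx = ℚP.*-cancelˡ-≤-pos D (begin
        D ℚ.* y                                      ≡⟨ D*y ⟩
        α ℚ.* 1ℚ ℚ.+ (B ℚ.- A) ℚ.* x                 ≡⟨ cong₂ (λ s t → α ℚ.* s ℚ.+ (B ℚ.- A) ℚ.* t) Σ≡1 cx ⟨
        α ℚ.* weightSum c ℚ.+ (B ℚ.- A) ℚ.* ccX V c  ≤⟨ affine-≤-ccY α (B ℚ.- A) D line≤H c c≥0 ⟩
        D ℚ.* ccY V H c                              ∎)
        where
        open ℚP.≤-Reasoning
        c≥0 = proj₁ (convex⇒nonNegWeights c cvx)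
        Σ≡1 = proj₂ (convex⇒nonNegWeights c cvx)
      on-chord-unique : ∀ {q} → D ℚ.* (q ℚ.- A) ≡ (x ℚ.- a) ℚ.* (B ℚ.- A) → q ≡ y
      on-chord-unique {q} q-on-chord = ∙-cancelʳ (ℚ.- A) q y (ℚP.≤-antisym
        (ℚP.*-cancelˡ-≤-pos D (ℚP.≤-reflexive (trans q-on-chord (sym y-on-chord))))
        (ℚP.*-cancelˡ-≤-pos D (ℚP.≤-reflexive (trans y-on-chord (sym q-on-chord)))))
      attained : ∀ ε → 0ℚ ℚ.< ε → ∃ λ c → IsConvex V c × ccX V c ≡ x × ccY V H c ℚ.< y ℚ.+ ε
      attained ε 0<ε =
        let c , cvx , cx , c-on-chord = chord a≤x x≤b in
        c , cvx , cx , subst (ℚ._< y ℚ.+ ε) (sym (on-chord-unique c-on-chord)) y<y+ε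
        where
        y<y+ε : y ℚ.< y ℚ.+ ε
        y<y+ε = subst (ℚ._< y ℚ.+ ε) (ℚP.+-identityʳ y) (ℚP.+-monoʳ-< y 0<ε)

  module _ (ns : ℕ → ℕ) (H₀≡0 : H 0 ≡ 0ℤ) (vertex-< : ∀ k → vertex ns k ℕ.< vertex ns (suc k))
           (supporting : ∀ k → SupportingChord H (vertex ns k) (vertex ns (suc k))) where

    private
      vX≡ : ∀ k → vX ns k ≡ ℕtoℚ (vertex ns k)
      vX≡ zero    = refl
      vX≡ (suc k) = refl

      vY≡ : ∀ k → vY H ns k ≡ ℤtoℚ (H (vertex ns k))
      vY≡ zero    rewrite H₀≡0 = refl
      vY≡ (suc k) = refl

      ℤtoℚ-[x-y]*z : ∀ x y z → ℤtoℚ ((x ℤ.- y) ℤ.* z) ≡ (ℤtoℚ x ℚ.- ℤtoℚ y) ℚ.* ℤtoℚ z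
      ℤtoℚ-[x-y]*z x y z = trans (ℤtoℚ-homo-* (x ℤ.- y) z) (cong (ℚ._* ℤtoℚ z) (ℤtoℚ-homo-- x y))

      supportingChord-ℚ : ∀ {a b} → SupportingChord H a b → ∀ ℓ →
        (ℕtoℚ b ℚ.- ℕtoℚ a) ℚ.* ℤtoℚ (H a) ℚ.+ (ℤtoℚ (H b) ℚ.- ℤtoℚ (H a)) ℚ.* (ℕtoℚ ℓ ℚ.- ℕtoℚ a)
          ℚ.≤ (ℕtoℚ b ℚ.- ℕtoℚ a) ℚ.* ℤtoℚ (H ℓ)
      supportingChord-ℚ {a} {b} chord≤H ℓ = subst₂ ℚ._≤_
        (trans (ℤtoℚ-homo-+ ((+ b ℤ.- + a) ℤ.* H a) ((H b ℤ.- H a) ℤ.* (+ ℓ ℤ.- + a)))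
          (cong₂ ℚ._+_ (ℤtoℚ-[x-y]*z (+ b) (+ a) (H a))
            (trans (ℤtoℚ-[x-y]*z (H b) (H a) (+ ℓ ℤ.- + a))
                   (cong ((ℤtoℚ (H b) ℚ.- ℤtoℚ (H a)) ℚ.*_) (ℤtoℚ-homo-- (+ ℓ) (+ a))))))
        (ℤtoℚ-[x-y]*z (+ b) (+ a) (H ℓ))
        (ℤtoℚ-mono-≤ (chord≤H ℓ))

      k≤vertex : ∀ k → k ℕ.≤ vertex ns k
      k≤vertex zero    = ℕ.z≤n
      k≤vertex (suc k) = ℕP.≤-trans (ℕ.s≤s (k≤vertex k)) (vertex-< k)

      onPolygon-segment : ∀ {x} k → vX ns k ℚ.≤ x → x ℚ.≤ vX ns (suc k) → ∃ λ y → OnPolygon H ns x y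
      onPolygon-segment {x} k a≤x x≤b =
        let c , _ , _ , c-on-chord = chord (ℤtoℚ-mono-< (ℤ.+<+ (vertex-< k))) (subst (ℚ._≤ x) (vX≡ k) a≤x) x≤b
        in ccY V H c , k , a≤x , x≤b ,
           subst₂ (λ a A → (vX ns (suc k) ℚ.- a) ℚ.* (ccY V H c ℚ.- A) ≡ (x ℚ.- a) ℚ.* (vY H ns (suc k) ℚ.- A))
                  (sym (vX≡ k)) (sym (vY≡ k)) c-on-chord

    onPolygon-exists : ∀ x → 0ℚ ℚ.≤ x → ∃ λ y → OnPolygon H ns x y
    onPolygon-exists x 0≤x =
      let k , a≤x , x≤b = segment (vX ns) M 0≤x (ℚP.≤-trans (q≤ℕtoℚ∣↥q∣ x) (ℤtoℚ-mono-≤ (ℤ.+≤+ M≤ns[M])))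
      in onPolygon-segment k a≤x x≤b
      where
      M = ℤ.∣ ℚ.↥ x ∣
      M≤ns[M] : M ℕ.≤ ns M
      M≤ns[M] = ℕP.≤-trans (ℕP.n≤1+n M) (k≤vertex (suc M))

    onPolygon⇒lowerHullValue : ∀ {x y} → OnPolygon H ns x y → IsLowerHullValue V H x y
    onPolygon⇒lowerHullValue (k , a≤x , x≤b , y-on-chord) with vX ns k | vX≡ k | vY H ns k | vY≡ k
    ... | _ | refl | _ | refl =
      chord⇒lowerHullValue (ℤtoℚ-mono-< (ℤ.+<+ (vertex-< k))) a≤x x≤b y-on-chord
        (supportingChord-ℚ {vertex ns k} {vertex ns (suc k)} (supporting k))

module Enumeration {n} (V : Fin n → Vec ℤ n) (linIndep : LinIndep V) (P : ℕ → Pt V)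
  (P-injective : ∀ i j → pt (P i) ≡ pt (P j) → i ≡ j)
  (P-surjective : ∀ (Q : Pt V) → ∃ λ i → pt (P i) ≡ pt Q)
  (P-weight-step : ∀ i → weight V (P i) ℚ.≤ weight V (P (suc i))) where

  weight-mono : ∀ {i j} → i ℕ.≤ j → weight V (P i) ℚ.≤ weight V (P j)
  weight-mono = mono-from-step (TotalPreorder.preorder ℚP.≤-totalPreorder) (weight V ∘ P) P-weight-step

  applyDownFrom-minWeightSet : ∀ ℓ → MinWeightSet V ℓ (applyDownFrom P ℓ)
  applyDownFrom-minWeightSet ℓ = ListP.length-applyDownFrom P ℓ , distinct , minimal
    where
    distinct : AllPairs (λ Q R → pt Q ≢ pt R) (applyDownFrom P ℓ)
    distinct = AllPairsP.applyDownFrom⁺₁ P ℓ (λ j<i _ Pi≡Pj → ℕP.<-irrefl (sym (P-injective _ _ Pi≡Pj)) j<i)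
    minimal : ∀ Q → pt Q ∉ map pt (applyDownFrom P ℓ) → ∀ R → R ∈ applyDownFrom P ℓ → weight V R ℚ.≤ weight V Q
    minimal Q Q∉ R R∈ with AnyP.applyDownFrom⁻ P R∈ | P-surjective Q
    ... | i , i<ℓ , refl | j , Pj≡Q with j ℕP.<? ℓ
    ...   | yes j<ℓ = ⊥-elim (Q∉ (subst (_∈ map pt (applyDownFrom P ℓ)) Pj≡Q
                                         (∈-map⁺ pt (AnyP.applyDownFrom⁺ P refl j<ℓ))))
    ...   | no  j≮ℓ = subst (weight V (P i) ℚ.≤_) (pt≡⇒weight≡ V linIndep (P j) Q Pj≡Q)
                        (weight-mono (ℕP.≤-trans (ℕP.<⇒≤ i<ℓ) (ℕP.≮⇒≥ j≮ℓ)))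

  no-jump-between-vertices : ∀ ns → (∀ k → vertex ns k ℕ.< vertex ns (suc k)) →
    (∀ j → weight V (P j) ℚ.< weight V (P (suc j)) → ∃ λ k → ns k ≡ suc j) →
    ∀ k j → vertex ns k ℕ.≤ j → suc j ℕ.< vertex ns (suc k) → ¬ weight V (P j) ℚ.< weight V (P (suc j))
  no-jump-between-vertices ns vertex-< jump⇒vertex k j a≤j 1+j<b jump =
    let k′ , ns[k′]≡1+j = jump⇒vertex j jump in
    strictMono-no-between (vertex ns) vertex-< {k} {suc k′}
      (subst (vertex ns k ℕ.<_) (sym ns[k′]≡1+j) (ℕ.s≤s a≤j))
      (subst (ℕ._< vertex ns (suc k)) (sym ns[k′]≡1+j) 1+j<b)

  module _ (p : ℕ) .{{_ : ℕ.NonZero p}} where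

    floorGap-weight : ℕ → ℤ
    floorGap-weight i = floorGap p (weight V (P i))

    h-minWeightSet≡∑ : ∀ {ℓ W} → MinWeightSet V ℓ W → h V p W ≡ ∑ floorGap-weight (downFrom ℓ)
    h-minWeightSet≡∑ {ℓ} {W} minW = begin
      h V p W                                        ≡⟨ minWeightSet-h-unique V linIndep p minW
                                                                             (applyDownFrom-minWeightSet ℓ) ⟩
      h V p (applyDownFrom P ℓ)                      ≡⟨ h≡∑ V linIndep p (applyDownFrom P ℓ) ⟩
      ∑ (floorGap p ∘ weight V) (applyDownFrom P ℓ)  ≡⟨ ∑-applyDownFrom ℓ ⟩
      ∑ floorGap-weight (downFrom ℓ)                 ∎
      where
      open ≡-Reasoning
      ∑-applyDownFrom : ∀ ℓ → ∑ (floorGap p ∘ weight V) (applyDownFrom P ℓ) ≡ ∑ floorGap-weight (downFrom ℓ)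
      ∑-applyDownFrom zero    = refl
      ∑-applyDownFrom (suc ℓ) = cong (ℤ._+_ (floorGap-weight ℓ)) (∑-applyDownFrom ℓ)

    h-supportingChord : (W : ℕ → List (Pt V)) → (∀ ℓ → MinWeightSet V ℓ (W ℓ)) → ∀ {a b} → a ℕ.≤ b →
      (∀ j → a ℕ.≤ j → suc j ℕ.< b → ¬ weight V (P j) ℚ.< weight V (P (suc j))) →
      SupportingChord (λ ℓ → h V p (W ℓ)) a b
    h-supportingChord W minW {a} {b} a≤b no-jump ℓ
      rewrite h-minWeightSet≡∑ (minW a) | h-minWeightSet≡∑ (minW b) | h-minWeightSet≡∑ (minW ℓ) =
      ∑-downFrom-supportingChord floorGap-weight (floorGap-mono-≤ p ∘ weight-mono) a≤b flat ℓ
      where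
      flat : ∀ j → a ℕ.≤ j → suc j ℕ.< b → floorGap-weight j ≡ floorGap-weight (suc j)
      flat j a≤j 1+j<b = cong (floorGap p) (ℚP.≤-antisym (P-weight-step j) (ℚP.≮⇒≥ (no-jump j a≤j 1+j<b)))

proposition3p12 : (n : ℕ) → 1 ≤ n → (V : Fin n → Vec ℤ n) → LinIndep V →
    (D : ℕ) → IsD V D →
    (p : ℕ) → Prime p → ¬ (p ∣ Vol V) → (n + 4) * D < p →
    (W : ℕ → List (Pt V)) → (∀ ℓ → MinWeightSet V ℓ (W ℓ)) →
    -- (1)
    (∀ ℓ m → 1 ≤ ℓ → 1 ≤ m →
      (∀ S → InMset V ℓ m S → (+ m) ℤ.* h V p (W ℓ) ℤ.≤ h V p S) ×
      (∃ λ S → InMset V ℓ m S × h V p S ≡ (+ m) ℤ.* h V p (W ℓ)))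
    ×
    -- (2)
    ((P : ℕ → Pt V) →
      (∀ i j → pt (P i) ≡ pt (P j) → i ≡ j) →
      (∀ (Q : Pt V) → ∃ λ i → pt (P i) ≡ pt Q) →
      (∀ i → weight V (P i) ℚ.≤ weight V (P (suc i))) →
      (ns : ℕ → ℕ) →
      (∀ k → ns k < ns (suc k)) →
      (∀ k → ∃ λ j → ns k ≡ suc j × weight V (P j) ℚ.< weight V (P (suc j))) →
      (∀ j → weight V (P j) ℚ.< weight V (P (suc j)) → ∃ λ k → ns k ≡ suc j) →
      ∀ (x : ℚ) → 0ℚ ℚ.≤ x →
        (∃ λ y → OnPolygon (λ ℓ → h V p (W ℓ)) ns x y) ×
        (∀ y → OnPolygon (λ ℓ → h V p (W ℓ)) ns x y →
          IsLowerHullValue V (λ ℓ → h V p (W ℓ)) x y))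
proposition3p12 n _ V linIndep D _ p p-prime _ _ W minW =
  (λ ℓ m _ _ → minWeightSet-exchange V linIndep p (minW ℓ) ,
               concat (replicate m (W ℓ)) , minWeightSet-replicate V linIndep p (minW ℓ) m) ,
  λ P P-injective P-surjective P-weight-step ns ns-< ns-jump jump⇒vertex x 0≤x →
    let open Enumeration V linIndep P P-injective P-surjective P-weight-step
        H = λ ℓ → h V p (W ℓ)
        j , ns₀≡1+j , _ = ns-jump 0
        vertices-< = vertex-< (subst (0 <_) (sym ns₀≡1+j) (ℕ.s≤s ℕ.z≤n)) ns-<
        supporting = λ k → h-supportingChord p W minW (ℕP.<⇒≤ (vertices-< k))
                             (no-jump-between-vertices ns vertices-< jump⇒vertex k)
        H₀≡0 = minWeightSet-h≡0 V linIndep p (minW 0)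
    in onPolygon-exists V H ns H₀≡0 vertices-< supporting x 0≤x ,
       λ _ → onPolygon⇒lowerHullValue V H ns H₀≡0 vertices-< supporting
  where
  instance
    p≢0 : ℕ.NonZero p
    p≢0 = prime⇒nonZero p-prime
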